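{- Let $\overrightarrow{G}=\overrightarrow{G}(V,E)$ be a thin 2-qBMG. If an automorphism $g$ of $\overrightarrow{G}$ fixes a vertex $v\in V$, then $g$ fixes every vertex of $N^-(v)$.
   Context: A digraph $\overrightarrow{G}=\overrightarrow{G}(V,E)$ has a finite vertex set $V$ and edge set $E\subseteq V\times V$ without loops ($uv$ denotes the edge with tail $u$ and head $v$; symmetric edges allowed). $N^+(v)=\{w:vw\in E\}$, $N^-(v)=\{w:wv\in E\}$. Two vertices $u,v$ are independent if neither $uv$ nor $vu$ is in $E$. A 2-qBMG is a digraph, equipped with a partition $V=U\cup W$ into two color classes such that every edge joins a vertex of $U$ and a vertex of $W$, satisfying: (N1) if $u,v$ are independent then there are no vertices $w,t$ with $ut,vw,tw\in E$; (N2) if $uv,vw,wt\in E$ then $ut\in E$; (N3) if $u,v$ have a common out-neighbor then $N^+(u)\subseteq N^+(v)$ or $N^+(v)\subseteq N^+(u)$. The digraph is thin if no two distinct vertices $x,y$ satisfy both $N^+(x)=N^+(y)$ and $N^-(x)=N^-(y)$. An automorphism is a permutation $\pi$ of $V$ with $xy\in E\Rightarrow\pi(x)\pi(y)\in E$. -}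

module Defs where

open import Data.Nat using (ℕ)
open import Data.Fin using (Fin)
open import Data.Bool using (Bool)
open import Data.Product using (_×_; ∃-syntax)
open import Data.Sum using (_⊎_)
open import Relation.Nullary using (¬_)
open import Relation.Binary.PropositionalEquality using (_≡_; _≢_)
open import Function.Bundles using (_↔_; _⇔_; Inverse)

-- A finite digraph on vertex set Fin n with edge relation E (E u v : edge uv,
-- tail u, head v), no loops.
record Digraph (n : ℕ) : Set₁ where
  field
    E     : Fin n → Fin n → Set
    loopless : ∀ v → ¬ E v v
open Digraph public

module _ {n : ℕ} (G : Digraph n) where
  private Ed = E G

  OutSub : Fin n → Fin n → Set
  OutSub u v = ∀ w → Ed u w → Ed v w

  Independent : Fin n → Fin n → Set
  Independent u v = ¬ Ed u v × ¬ Ed v u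

  Properly2Colored : (Fin n → Bool) → Set
  Properly2Colored col = ∀ u v → Ed u v → col u ≢ col v

  N1 : Set
  N1 = ∀ u v w t → Independent u v → ¬ (Ed u t × Ed v w × Ed t w)

  N2 : Set
  N2 = ∀ u v w t → Ed u v → Ed v w → Ed w t → Ed u t

  N3 : Set
  N3 = ∀ u v → (∃[ w ] (Ed u w × Ed v w)) → OutSub u v ⊎ OutSub v u

  Is2qBMG : (Fin n → Bool) → Set
  Is2qBMG col = Properly2Colored col × N1 × N2 × N3

  Thin : Set
  Thin = ∀ x y → x ≢ y →
    ¬ ((∀ w → Ed x w ⇔ Ed y w) × (∀ w → Ed w x ⇔ Ed w y))

  IsAutomorphism : (Fin n ↔ Fin n) → Set
  IsAutomorphism π = ∀ x y → Ed x y → Ed (Inverse.to π x) (Inverse.to π y)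

{-# OPTIONS --safe #-}
module Submission where

-- Since u → v and g fixes v, also g u → v, so u and g u have a common out-neighbour.
-- Axiom (N3) then makes their out-neighbourhoods comparable, and (N1) together with
-- (N2) does the same for their in-neighbourhoods.  But g has finite order, so an
-- inclusion N(u) ⊆ N(g u) propagates along the orbit N(g u) ⊆ N(g² u) ⊆ … ⊆ N(u) and
-- is an equality.  Hence u and g u are twins, and thinness forces g u = u.

open import Defs
open import Level using (Level)
open import Data.Nat using (ℕ; zero; suc; _+_; _*_)
open import Data.Nat.GeneralisedArithmetic using (fold; fold-+)
open import Data.Nat.Properties using (n<1+n; <⇒≢; *-comm)
open import Data.Fin as Fin using (Fin; toℕ; _≟_)
open import Data.Fin.Properties using (pigeonhole; any?)
open import Data.List using ([]; _∷_; allFin)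
open import Data.List.Relation.Unary.All as All using (All; []; _∷_)
open import Data.List.Membership.Propositional.Properties using (∈-allFin)
open import Data.Bool using (Bool)
open import Data.Product using (_×_; _,_; proj₁; proj₂; ∃-syntax)
open import Data.Empty using (⊥-elim)
open import Data.Sum using (_⊎_; inj₁; inj₂)
open import Function.Base using (_∘_; flip)
open import Function.Bundles using (_↔_; _⇔_; mk⇔; Inverse; Injection)
open import Function.Properties.Inverse using (↔⇒↣)
open import Relation.Nullary using (¬_; Dec; yes; no)
open import Relation.Nullary.Decidable using (decidable-stable; ¬¬-excluded-middle; _×-dec_; ¬?)
open import Relation.Unary using (Pred)
open import Relation.Binary using (Rel; Reflexive; Transitive)
open import Relation.Binary.PropositionalEquality using (_≡_; _≢_; refl; sym; trans; cong; subst; subst₂)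

private
  variable
    a ℓ : Level
    A : Set a
    n : ℕ

module _ {R : Rel A ℓ} {f : A → A} (f-preserves : ∀ {x y} → R x y → R (f x) (f y)) where

  fold-preserves : ∀ k {x y} → R x y → R (fold x f k) (fold y f k)
  fold-preserves zero    r = r
  fold-preserves (suc k) {x} {y} r =
    f-preserves {fold x f k} {fold y f k} (fold-preserves k r)

  module _ (R-refl : Reflexive R) (R-trans : Transitive R) {x : A} (x≤fx : R x (f x)) where

    private
      step : ∀ k → R (fold x f k) (fold x f (suc k))
      step zero    = x≤fx
      step (suc k) = f-preserves {fold x f k} {fold x f (suc k)} (step k)

      fx≤ : ∀ m → R (f x) (fold x f (suc m))
      fx≤ zero    = R-refl
      fx≤ (suc m) = R-trans (fx≤ m) (step (suc m))

    x≤fx⇒fx≤x : ∃[ p ] fold x f (suc p) ≡ x → R (f x) x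
    x≤fx⇒fx≤x (p , period) = subst (R (f x)) period (fx≤ p)

comparable⇒equivalent : {R : Rel A ℓ} → Reflexive R → Transitive R →
                        {f : A → A} → (∀ {x y} → R x y → R (f x) (f y)) →
                        ∀ {x} → ∃[ p ] fold x f (suc p) ≡ x →
                        R x (f x) ⊎ R (f x) x → R x (f x) × R (f x) x
comparable⇒equivalent {R = R} R-refl R-trans {f} f-preserves periodic (inj₁ x≤fx) =
  x≤fx , x≤fx⇒fx≤x {R = R} {f} f-preserves R-refl R-trans x≤fx periodic
comparable⇒equivalent {R = R} R-refl R-trans {f} f-preserves periodic (inj₂ fx≤x) =
  x≤fx⇒fx≤x {R = flip R} {f} (λ {x} {y} → f-preserves {y} {x}) R-refl (flip R-trans) fx≤x periodic , fx≤x

fold-period-multiple : {f : A → A} {x : A} (p : ℕ) → fold x f (suc p) ≡ x →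
                       ∀ m → fold x f (m * suc p) ≡ x
fold-period-multiple p period zero = refl
fold-period-multiple {f = f} {x} p period (suc m) =
  trans (fold-+ x f (suc p)) (trans (cong (λ y → fold y f (suc p)) (fold-period-multiple p period m)) period)

module _ (f : Fin n → Fin n) (f-injective : ∀ {x y} → f x ≡ f y → x ≡ y) where

  private
    collision⇒period : ∀ {x} i j → i ≢ j → fold x f i ≡ fold x f j → ∃[ p ] fold x f (suc p) ≡ x
    collision⇒period zero    zero    i≢j _  = ⊥-elim (i≢j refl)
    collision⇒period zero    (suc j) _   eq = j , sym eq
    collision⇒period (suc i) zero    _   eq = i , eq
    collision⇒period (suc i) (suc j) i≢j eq = collision⇒period i j (i≢j ∘ cong suc) (f-injective eq)

  period : ∀ x → ∃[ p ] fold x f (suc p) ≡ x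
  period x with pigeonhole (n<1+n n) (λ (i : Fin (suc n)) → fold x f (toℕ i))
  ... | i , j , i<j , eq = collision⇒period (toℕ i) (toℕ j) (<⇒≢ i<j) eq

  common-period : ∀ xs → ∃[ p ] All (λ x → fold x f (suc p) ≡ x) xs
  common-period []       = 0 , []
  common-period (x ∷ xs) with period x | common-period xs
  ... | p , px | q , qs =
    q + p * suc q ,
    subst (λ k → fold x f k ≡ x) (*-comm (suc q) (suc p)) (fold-period-multiple {f = f} p px (suc q)) ∷
    All.map (λ qy → fold-period-multiple {f = f} q qy (suc p)) qs

  finite-order : ∃[ p ] ∀ x → fold x f (suc p) ≡ x
  finite-order with common-period (allFin n)
  ... | p , returns = p , λ x → All.lookup returns (∈-allFin x)

¬¬-∀-Fin : {P : Pred (Fin n) ℓ} → (∀ i → ¬ ¬ P i) → ¬ ¬ (∀ i → P i)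
¬¬-∀-Fin {zero}  _    k = k λ ()
¬¬-∀-Fin {suc n} ¬¬P k =
  ¬¬P Fin.zero λ p₀ → ¬¬-∀-Fin (¬¬P ∘ Fin.suc) λ ps → k λ { Fin.zero → p₀ ; (Fin.suc i) → ps i }

¬¬-decidable : (R : Rel (Fin n) ℓ) → ¬ ¬ (∀ a b → Dec (R a b))
¬¬-decidable R = ¬¬-∀-Fin λ a → ¬¬-∀-Fin λ b → ¬¬-excluded-middle

reverse : Digraph n → Digraph n
reverse G = record { E = flip (E G) ; loopless = loopless G }

reverse-isAutomorphism : (G : Digraph n) (g : Fin n ↔ Fin n) →
                         IsAutomorphism G g → IsAutomorphism (reverse G) g
reverse-isAutomorphism G g g-aut x y = g-aut y x

module _ (G : Digraph n) (g : Fin n ↔ Fin n) (g-aut : IsAutomorphism G g) where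

  open Inverse g using (to; from; strictlyInverseˡ; strictlyInverseʳ)

  private
    order : ∃[ p ] ∀ x → fold x to (suc p) ≡ x
    order = finite-order to (Injection.injective (↔⇒↣ g))

    p : ℕ
    p = proj₁ order

    from≡fold : ∀ x → from x ≡ fold x to p
    from≡fold x = trans (cong from (sym (proj₂ order x))) (strictlyInverseʳ (fold x to p))

  from-preserves : ∀ {x y} → E G x y → E G (from x) (from y)
  from-preserves {x} {y} e =
    subst₂ (E G) (sym (from≡fold x)) (sym (from≡fold y)) (fold-preserves {R = E G} {to} (λ {a} {b} → g-aut a b) p e)

  OutSub-preserved : ∀ {a b} → OutSub G a b → OutSub G (to a) (to b)
  OutSub-preserved {a} {b} a⊆b w e =
    subst (E G (to b)) (strictlyInverseˡ w)
      (g-aut _ _ (a⊆b (from w) (subst (λ z → E G z (from w)) (strictlyInverseʳ a) (from-preserves e))))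

  comparable-out-neighbourhoods-coincide : ∀ {x} → OutSub G x (to x) ⊎ OutSub G (to x) x →
                                           ∀ w → E G x w ⇔ E G (to x) w
  comparable-out-neighbourhoods-coincide {x} comparable w =
    let x⊆gx , gx⊆x = comparable⇒equivalent {R = OutSub G} (λ w e → e) (λ s t w e → t w (s w e))
                        {to} (λ {a} {b} → OutSub-preserved {a} {b}) (p , proj₂ order x) comparable
    in mk⇔ (x⊆gx w) (gx⊆x w)

module _ (G : Digraph n) (E? : ∀ a b → Dec (E G a b)) (n1 : N1 G) (n2 : N2 G) where

  N1⇒back-edge : ∀ {x a b v} → E G x a → E G a v → E G b v → ¬ E G x b → E G b x
  N1⇒back-edge {x} {a} {b} {v} xa av bv ¬xb =
    decidable-stable (E? b x) λ ¬bx → n1 x b v a (¬xb , ¬bx) (xa , bv , av)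

  in-neighbourhoods-comparable : ∀ {a b v} → E G a v → E G b v →
                                 OutSub (reverse G) a b ⊎ OutSub (reverse G) b a
  in-neighbourhoods-comparable {a} {b} av bv with any? (λ x → E? x a ×-dec ¬? (E? x b))
  ... | yes (x , xa , ¬xb) = inj₂ λ y yb → n2 y b x a yb (N1⇒back-edge xa av bv ¬xb) xa
  ... | no ∄x = inj₁ λ x xa → decidable-stable (E? x b) λ ¬xb → ∄x (x , xa , ¬xb)

proposition5p2 : (n : ℕ) (G : Digraph n) (col : Fin n → Bool) →
    Is2qBMG G col → Thin G →
    (g : Fin n ↔ Fin n) → IsAutomorphism G g →
    (v : Fin n) → Inverse.to g v ≡ v →
    ∀ u → E G u v → Inverse.to g u ≡ u
proposition5p2 n G col (_ , n1 , n2 , n3) thin g g-aut v gv≡v u uv =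
  -- equality on Fin n is decidable, so we may argue classically about the edge relation
  decidable-stable (to u ≟ u) λ gu≢u → ¬¬-decidable (E G) λ E? →
    thin u (to u) (gu≢u ∘ sym)
      ( comparable-out-neighbourhoods-coincide G g g-aut (n3 u (to u) (v , uv , guv))
      , comparable-out-neighbourhoods-coincide (reverse G) g (reverse-isAutomorphism G g g-aut)
          (in-neighbourhoods-comparable G E? n1 n2 uv guv) )
  where
  open Inverse g using (to)

  guv : E G (to u) v
  guv = subst (E G (to u)) gv≡v (g-aut u v uv)
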